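{- Let $k\ge2$ and let $p\in S_k$ be a permutation in which the letter $1$ is immediately followed by the letter $k$; let $j=p^{ -1}(1)$ be the index of $1$ in $p$. If a permutation $\pi\in S_n$ avoids the bivincular pattern $(p,\{j\},\emptyset)$, then $\pi$ also avoids the bivincular pattern $(p,\emptyset,\{2,3,\dots,k-2\})$.
   Context: A bivincular pattern is a triple $(p,X,Y)$ with $p\in S_k$ and $X,Y\subseteq\{0,\dots,k\}$. An occurrence of $(p,X,Y)$ in $\pi\in S_n$ is a subsequence $\pi_{i_1}\cdots\pi_{i_k}$ ($i_1<\dots<i_k$) whose letters are in the same relative order as those of $p$, such that $i_{x+1}=i_x+1$ for all $x\in X$ and $j_{y+1}=j_y+1$ for all $y\in Y$, where $j_1<\dots<j_k$ are the values of the subsequence in increasing order (conventions $i_0=j_0=0$, $i_{k+1}=j_{k+1}=n+1$). $\pi$ avoids the pattern if there is no occurrence. (The set $\{2,\dots,k-2\}$ is empty when $k\le 3$.) -}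

module Defs where

open import Data.Nat as ℕ using (ℕ; zero; suc; _∸_)
open import Data.Fin as Fin using (Fin; toℕ; fromℕ<)
open import Data.Fin.Permutation using (Permutation′; _⟨$⟩ʳ_; _⟨$⟩ˡ_)
open import Data.Product using (Σ; _×_)
open import Data.Empty using (⊥)
open import Relation.Nullary using (¬_; yes; no)
open import Relation.Binary.PropositionalEquality using (_≡_)

-- Conventions: permutations in S_m are 'Permutation′ m' on Fin m = {0,…,m-1}
-- (0-based letters/positions); p ⟨$⟩ʳ a is the letter at position a.
-- The index sets X, Y of a bivincular pattern are predicates on ℕ, read with the
-- paper's 1-based conventions (elements of {0,…,k}).

ext : (k n : ℕ) → (Fin k → Fin n) → ℕ → ℕ
ext k n f zero = 0
ext k n f (suc x) with x ℕ.<? k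
... | yes x<k = suc (toℕ (f (fromℕ< x<k)))
... | no _    = suc n

-- An occurrence of the bivincular pattern (p, X, Y) in π.
-- 'pos' gives the positions i_1 < … < i_k (0-based); the subsequence is order
-- isomorphic to p; the values in increasing order are j_r = π(i_{p⁻¹(r)}).
record Occurrence {k n : ℕ} (p : Permutation′ k) (X Y : ℕ → Set)
                  (π : Permutation′ n) : Set where
  field
    pos      : Fin k → Fin n
    pos-inc  : ∀ a b → a Fin.< b → pos a Fin.< pos b
    order    : ∀ a b → (p ⟨$⟩ʳ a) Fin.< (p ⟨$⟩ʳ b)
                     → (π ⟨$⟩ʳ pos a) Fin.< (π ⟨$⟩ʳ pos b)
    order⁻   : ∀ a b → (π ⟨$⟩ʳ pos a) Fin.< (π ⟨$⟩ʳ pos b)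
                     → (p ⟨$⟩ʳ a) Fin.< (p ⟨$⟩ʳ b)
    adjPos   : ∀ x → x ℕ.≤ k → X x →
               ext k n pos (suc x) ≡ suc (ext k n pos x)
    adjVal   : ∀ y → y ℕ.≤ k → Y y →
               ext k n (λ r → π ⟨$⟩ʳ pos (p ⟨$⟩ˡ r)) (suc y)
                 ≡ suc (ext k n (λ r → π ⟨$⟩ʳ pos (p ⟨$⟩ˡ r)) y)

Avoids : {k n : ℕ} → Permutation′ n → Permutation′ k → (X Y : ℕ → Set) → Set
Avoids π p X Y = ¬ Occurrence p X Y π

∅ : ℕ → Set
∅ _ = ⊥

-- Take an occurrence in which the letters 2, …, k−1 of p receive the
-- consecutive values m, m+1, …, m+k−3.  Walking through the positions from the
-- occurrence of 1 (value < m) to that of k (value ≥ m) we meet adjacent positions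
-- t, t+1 with π(t) < m ≤ π(t+1).  Position t+1 lies between the outer letters, so
-- it carries none of the block values, and hence π(t+1) lies above the whole block.
-- Moving the letter 1 to position t and the letter k to position t+1 therefore
-- yields an occurrence in which 1 and k are adjacent.
module Submission where

open import Defs
open import Data.Nat using (ℕ; suc; _≤_; _∸_)
open import Data.Fin using (Fin; toℕ)
open import Data.Fin.Permutation using (Permutation′; _⟨$⟩ʳ_)
open import Data.Product using (_×_)
open import Relation.Binary.PropositionalEquality using (_≡_)

open import Data.Nat using (zero; _+_; _<_; z≤n; s≤s; s≤s⁻¹; s<s⁻¹; _<?_)
open import Data.Nat.Properties hiding (_≟_)
open import Data.Fin as Fin using (fromℕ<)
open import Data.Fin.Properties
  using (toℕ-injective; toℕ-fromℕ<; fromℕ<-toℕ; toℕ<n; _≟_)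
open import Data.Fin.Permutation using (_⟨$⟩ˡ_; inverseʳ)
open import Data.Vec.Functional using (updateAt)
open import Data.Vec.Functional.Properties using (updateAt-updates; updateAt-minimal)
open import Data.Product using (Σ; _,_; proj₁; proj₂)
open import Data.Sum using (_⊎_; inj₁; inj₂)
open import Function using (_∘_; const)
open import Function.Bundles using (Injection)
open import Function.Properties.Inverse using (↔⇒↣)
open import Relation.Binary.Definitions using (tri<; tri≈; tri>)
open import Relation.Nullary using (¬_; Dec; yes; no; contradiction)
open import Relation.Nullary.Decidable using (map′)
open import Relation.Unary using (Decidable)
open import Relation.Binary.PropositionalEquality
  using (_≢_; refl; sym; trans; cong; subst; subst₂; module ≡-Reasoning)

ext-suc : ∀ {k n} (f : Fin k → Fin n) x (x<k : x < k) →
          ext k n f (suc x) ≡ suc (toℕ (f (fromℕ< x<k)))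
ext-suc {k} f x x<k with x <? k
... | yes _   = refl
... | no x≮k = contradiction x<k x≮k

ext-toℕ : ∀ {k n} (f : Fin k → Fin n) b → ext k n f (suc (toℕ b)) ≡ suc (toℕ (f b))
ext-toℕ f b = trans (ext-suc f (toℕ b) (toℕ<n b)) (cong (suc ∘ toℕ ∘ f) (fromℕ<-toℕ b _))

toℕ-⟨$⟩ʳ-injective : ∀ {m} (σ : Permutation′ m) {b c} →
                     toℕ (σ ⟨$⟩ʳ b) ≡ toℕ (σ ⟨$⟩ʳ c) → b ≡ c
toℕ-⟨$⟩ʳ-injective σ = Injection.injective (↔⇒↣ σ) ∘ toℕ-injective

preserves⇒reflects : ∀ {A : Set} {f g : A → ℕ} → (∀ {b c} → f b ≡ f c → b ≡ c) →
                     (∀ b c → f b < f c → g b < g c) → ∀ b c → g b < g c → f b < f c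
preserves⇒reflects {f = f} {g} f-inj mono b c gb<gc with <-cmp (f b) (f c)
... | tri< fb<fc _ _ = fb<fc
... | tri≈ _ fb≡fc _ = contradiction (subst (λ x → g b < g x) (sym (f-inj fb≡fc)) gb<gc) (<-irrefl refl)
... | tri> _ _ fc<fb = contradiction gb<gc (<-asym (mono c b fc<fb))

record Crossing (P : ℕ → Set) (lo hi : ℕ) : Set where
  field
    point    : ℕ
    lo≤point : lo ≤ point
    point<hi : point < hi
    holds    : P point
    fails    : ¬ P (suc point)

crossing : ∀ {P : ℕ → Set} → Decidable P → ∀ {lo hi} → lo ≤ hi → P lo → ¬ P hi → Crossing P lo hi
crossing P? {hi = zero} z≤n P0 ¬P0 = contradiction P0 ¬P0
crossing {P} P? {lo} {suc h} lo≤1+h Plo ¬P1+h = step (P? h)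
  where
    lo≤h : lo ≤ h
    lo≤h = s≤s⁻¹ (≤∧≢⇒< lo≤1+h (λ lo≡1+h → ¬P1+h (subst P lo≡1+h Plo)))

    step : Dec (P h) → Crossing P lo (suc h)
    step (yes Ph) = record { point = h ; lo≤point = lo≤h ; point<hi = ≤-refl ; holds = Ph ; fails = ¬P1+h }
    step (no ¬Ph) = record { point = point ; lo≤point = lo≤point ; point<hi = m<n⇒m<1+n point<hi
                           ; holds = holds ; fails = fails }
      where open Crossing (crossing P? lo≤h Plo ¬Ph)

avoids-run⇒above : ∀ (w : ℕ → ℕ) {x} → w 0 ≤ x → ∀ d →
                   (∀ i → i < d → w (suc i) ≡ suc (w i)) → (∀ i → i ≤ d → w i ≢ x) → w d < x
avoids-run⇒above w w0≤x zero    _    avoids = ≤∧≢⇒< w0≤x (avoids 0 z≤n)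
avoids-run⇒above w {x} w0≤x (suc d) step avoids = ≤∧≢⇒< w[1+d]≤x (avoids (suc d) ≤-refl)
  where
    wd<x : w d < x
    wd<x = avoids-run⇒above w w0≤x d (λ i i<d → step i (m<n⇒m<1+n i<d))
                                     (λ i i≤d → avoids i (m≤n⇒m≤1+n i≤d))
    w[1+d]≤x : w (suc d) ≤ x
    w[1+d]≤x = subst (_≤ _) (sym (step d ≤-refl)) wd<x

Outside : ∀ {k} → Fin k → Fin k → Fin k → Set
Outside a a′ b = b Fin.< a ⊎ a′ Fin.< b

module _ {k : ℕ} {a a′ : Fin k} (a′≡1+a : toℕ a′ ≡ suc (toℕ a)) where

  a<a′ : a Fin.< a′
  a<a′ = subst (toℕ a <_) (sym a′≡1+a) ≤-refl

  outside-adjacent : ∀ {b} → b ≢ a → b ≢ a′ → Outside a a′ b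
  outside-adjacent {b} b≢a b≢a′ with <-cmp (toℕ b) (toℕ a)
  ... | tri< b<a _ _    = inj₁ b<a
  ... | tri≈ _ b≡a _    = contradiction (toℕ-injective b≡a) b≢a
  ... | tri> _ _ a<b    =
    inj₂ (≤∧≢⇒< (subst (_≤ toℕ b) (sym a′≡1+a) a<b) (b≢a′ ∘ sym ∘ toℕ-injective))

  outside⇒≢ : ∀ {b} → Outside a a′ b → b ≢ a × b ≢ a′
  outside⇒≢ (inj₁ b<a)  = <⇒≢ b<a ∘ cong toℕ , <⇒≢ (<-trans b<a a<a′) ∘ cong toℕ
  outside⇒≢ (inj₂ a′<b) = >⇒≢ (<-trans a<a′ a′<b) ∘ cong toℕ , >⇒≢ a′<b ∘ cong toℕ

module ReplaceAdjacent {k n : ℕ} (f : Fin k → Fin n) {a a′ : Fin k}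
                       (a′≡1+a : toℕ a′ ≡ suc (toℕ a)) (s t : Fin n) where

  replaced : Fin k → Fin n
  replaced = updateAt (updateAt f a′ (const t)) a (const s)

  replaced-a : replaced a ≡ s
  replaced-a = updateAt-updates a _

  replaced-a′ : replaced a′ ≡ t
  replaced-a′ = trans (updateAt-minimal a′ a _ (>⇒≢ (a<a′ a′≡1+a) ∘ cong toℕ)) (updateAt-updates a′ f)

  replaced-elsewhere : ∀ {b} → b ≢ a → b ≢ a′ → replaced b ≡ f b
  replaced-elsewhere {b} b≢a b≢a′ = trans (updateAt-minimal b a _ b≢a) (updateAt-minimal b a′ f b≢a′)

  data View (b : Fin k) : Fin n → Set where
    at-a      : b ≡ a  → View b s
    at-a′     : b ≡ a′ → View b t
    elsewhere : Outside a a′ b → View b (f b)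

  view : ∀ b → View b (replaced b)
  view b with b ≟ a | b ≟ a′
  ... | yes refl | _        = subst (View a) (sym replaced-a) (at-a refl)
  ... | no _     | yes refl = subst (View a′) (sym replaced-a′) (at-a′ refl)
  ... | no b≢a   | no b≢a′  = subst (View b) (sym (replaced-elsewhere b≢a b≢a′))
                                    (elsewhere (outside-adjacent a′≡1+a b≢a b≢a′))

  replaced-increasing : (∀ b c → b Fin.< c → f b Fin.< f c) →
                        f a Fin.≤ s → s Fin.< t → t Fin.≤ f a′ →
                        ∀ b c → b Fin.< c → replaced b Fin.< replaced c
  replaced-increasing f-inc fa≤s s<t t≤fa′ b c b<c with replaced b | view b | replaced c | view c
  ... | _ | at-a refl             | _ | at-a′ refl            = s<t
  ... | _ | at-a refl             | _ | elsewhere (inj₂ a′<c) = <-trans s<t (≤-<-trans t≤fa′ (f-inc a′ c a′<c))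
  ... | _ | at-a′ refl            | _ | elsewhere (inj₂ a′<c) = ≤-<-trans t≤fa′ (f-inc a′ c a′<c)
  ... | _ | elsewhere (inj₁ b<a)  | _ | at-a refl             = <-≤-trans (f-inc b a b<a) fa≤s
  ... | _ | elsewhere (inj₁ b<a)  | _ | at-a′ refl            = <-trans (<-≤-trans (f-inc b a b<a) fa≤s) s<t
  ... | _ | elsewhere _           | _ | elsewhere _           = f-inc b c b<c
  ... | _ | at-a refl             | _ | at-a refl             = contradiction b<c (<-irrefl refl)
  ... | _ | at-a′ refl            | _ | at-a′ refl            = contradiction b<c (<-irrefl refl)
  ... | _ | at-a refl             | _ | elsewhere (inj₁ c<a)  = contradiction c<a (<-asym b<c)
  ... | _ | at-a′ refl            | _ | at-a refl             = contradiction b<c (<-asym (a<a′ a′≡1+a))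
  ... | _ | at-a′ refl            | _ | elsewhere (inj₁ c<a)  = contradiction (<-trans b<c c<a) (<-asym (a<a′ a′≡1+a))
  ... | _ | elsewhere (inj₂ a′<b) | _ | at-a refl             = contradiction (<-trans a′<b b<c) (<-asym (a<a′ a′≡1+a))
  ... | _ | elsewhere (inj₂ a′<b) | _ | at-a′ refl            = contradiction a′<b (<-asym b<c)

  replaced-adjacent : toℕ t ≡ suc (toℕ s) →
                      ext k n replaced (suc (suc (toℕ a))) ≡ suc (ext k n replaced (suc (toℕ a)))
  replaced-adjacent t≡1+s = begin
    ext k n replaced (suc (suc (toℕ a))) ≡⟨ cong (ext k n replaced ∘ suc) a′≡1+a ⟨
    ext k n replaced (suc (toℕ a′))      ≡⟨ ext-toℕ replaced a′ ⟩
    suc (toℕ (replaced a′))              ≡⟨ cong (suc ∘ toℕ) replaced-a′ ⟩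
    suc (toℕ t)                          ≡⟨ cong suc t≡1+s ⟩
    suc (suc (toℕ s))                    ≡⟨ cong (suc ∘ suc ∘ toℕ) replaced-a ⟨
    suc (suc (toℕ (replaced a)))         ≡⟨ cong suc (ext-toℕ replaced a) ⟨
    suc (ext k n replaced (suc (toℕ a))) ∎
    where open ≡-Reasoning

-- The pattern has length 2 + k here; ranks are 0-based, so 1 and k of the paper
-- are the letters of rank 0 and suc k.
module Relocation (k : ℕ) (p : Permutation′ (2 + k)) {a a′ : Fin (2 + k)}
                  (a′≡1+a : toℕ a′ ≡ suc (toℕ a))
                  (rank-a : toℕ (p ⟨$⟩ʳ a) ≡ 0) (rank-a′ : toℕ (p ⟨$⟩ʳ a′) ≡ suc k)
                  {n : ℕ} (π : Permutation′ n)
                  (occ : Occurrence p ∅ (λ y → (2 ≤ y) × (y ≤ k)) π) where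

  open Occurrence occ

  rank : Fin (2 + k) → ℕ
  rank b = toℕ (p ⟨$⟩ʳ b)

  value : Fin n → ℕ
  value i = toℕ (π ⟨$⟩ʳ i)

  letter : ∀ {r} → r < 2 + k → Fin (2 + k)
  letter r<2+k = p ⟨$⟩ˡ fromℕ< r<2+k

  rank-letter : ∀ {r} (r<2+k : r < 2 + k) → rank (letter r<2+k) ≡ r
  rank-letter r<2+k = trans (cong toℕ (inverseʳ p)) (toℕ-fromℕ< r<2+k)

  letter-outside : ∀ {r} (r<2+k : r < 2 + k) → 1 ≤ r → r ≤ k → Outside a a′ (letter r<2+k)
  letter-outside r<2+k 1≤r r≤k = outside-adjacent a′≡1+a
    (λ ≡a → <⇒≢ 1≤r (sym (trans (sym (rank-letter r<2+k)) (trans (cong rank ≡a) rank-a))))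
    (λ ≡a′ → <⇒≢ (s≤s r≤k) (trans (sym (rank-letter r<2+k)) (trans (cong rank ≡a′) rank-a′)))

  1<2+k : 1 < 2 + k
  1<2+k = s≤s (s≤s z≤n)

  m : ℕ
  m = value (pos (letter 1<2+k))

  m≤value : ∀ {c} → c ≢ a → m ≤ value (pos c)
  m≤value {c} c≢a = ≮⇒≥ λ below-m → c≢a (toℕ-⟨$⟩ʳ-injective p
    (trans (n<1⇒n≡0 (subst (rank c <_) (rank-letter 1<2+k) (order⁻ c _ below-m))) (sym rank-a)))

  value-a<m : value (pos a) < m
  value-a<m = order a _ (subst₂ _<_ (sym rank-a) (sym (rank-letter 1<2+k)) ≤-refl)

  Below : ℕ → Set
  Below i = Σ (i < n) λ i<n → value (fromℕ< i<n) < m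

  below? : Decidable Below
  below? i with i <? n
  ... | no i≮n  = no (i≮n ∘ proj₁)
  ... | yes i<n = map′ (i<n ,_) proj₂ (value (fromℕ< i<n) <? m)

  open Crossing (crossing below? (<⇒≤ (pos-inc a a′ (a<a′ a′≡1+a)))
    (toℕ<n (pos a) , subst (λ i → value i < m) (sym (fromℕ<-toℕ (pos a) _)) value-a<m)
    (λ (i<n , below-m) → <⇒≱ (subst (λ i → value i < m) (fromℕ<-toℕ (pos a′) i<n) below-m)
                              (m≤value (>⇒≢ (a<a′ a′≡1+a) ∘ cong toℕ))))
    renaming (point to t)

  1+t<n : suc t < n
  1+t<n = ≤-<-trans point<hi (toℕ<n (pos a′))

  T T′ : Fin n
  T  = fromℕ< (proj₁ holds)
  T′ = fromℕ< 1+t<n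

  toℕ-T : toℕ T ≡ t
  toℕ-T = toℕ-fromℕ< _

  toℕ-T′ : toℕ T′ ≡ suc t
  toℕ-T′ = toℕ-fromℕ< _

  T′≢pos : ∀ {b} → Outside a a′ b → T′ ≢ pos b
  T′≢pos (inj₁ b<a)  T′≡ = <-irrefl (trans (sym (cong toℕ T′≡)) toℕ-T′)
    (m<n⇒m<1+n (<-≤-trans (pos-inc _ a b<a) lo≤point))
  T′≢pos (inj₂ a′<b) T′≡ = <-irrefl (trans (sym toℕ-T′) (cong toℕ T′≡))
    (≤-<-trans point<hi (pos-inc a′ _ a′<b))

  value-T<m : value T < m
  value-T<m = proj₂ holds

  m≤value-T′ : m ≤ value T′
  m≤value-T′ = ≮⇒≥ (fails ∘ (1+t<n ,_))

  block : ℕ → ℕ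
  block i = ext (2 + k) n (λ r → π ⟨$⟩ʳ pos (p ⟨$⟩ˡ r)) (2 + i)

  block-letter : ∀ i (1+i<2+k : suc i < 2 + k) → block i ≡ suc (value (pos (letter 1+i<2+k)))
  block-letter i = ext-suc _ (suc i)

  block-consecutive : ∀ i → 2 + i ≤ k → block (suc i) ≡ suc (block i)
  block-consecutive i 2+i≤k = adjVal (2 + i) (m≤n⇒m≤o+n 2 2+i≤k) (s≤s (s≤s z≤n) , 2+i≤k)

  letter-below-T′ : ∀ d (1+d<2+k : suc d < 2 + k) → suc d ≤ k → value (pos (letter 1+d<2+k)) < value T′
  letter-below-T′ d 1+d<2+k 1+d≤k = s<s⁻¹ (subst (_< suc (value T′)) (block-letter d 1+d<2+k)
    (avoids-run⇒above block block0≤ d (λ i i<d → block-consecutive i (≤-trans (s≤s i<d) 1+d≤k)) avoids))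
    where
      block0≤ : block 0 ≤ suc (value T′)
      block0≤ = subst (_≤ suc (value T′)) (sym (block-letter 0 1<2+k)) (s≤s m≤value-T′)

      avoids : ∀ i → i ≤ d → block i ≢ suc (value T′)
      avoids i i≤d block-i≡ = T′≢pos (letter-outside 1+i<2+k (s≤s z≤n) (≤-trans (s≤s i≤d) 1+d≤k))
        (sym (toℕ-⟨$⟩ʳ-injective π (suc-injective (trans (sym (block-letter i 1+i<2+k)) block-i≡))))
        where 1+i<2+k = ≤-<-trans (s≤s i≤d) 1+d<2+k

  outside-below-T′ : ∀ {b} → Outside a a′ b → value (pos b) < value T′
  outside-below-T′ {b} out with rank b in rank-b
  ... | zero  = contradiction (toℕ-⟨$⟩ʳ-injective p (trans rank-b (sym rank-a))) (proj₁ (outside⇒≢ a′≡1+a out))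
  ... | suc d = subst (λ c → value (pos c) < value T′) letter≡b (letter-below-T′ d 1+d<2+k 1+d≤k)
    where
      1+d<2+k : suc d < 2 + k
      1+d<2+k = subst (_< 2 + k) rank-b (toℕ<n (p ⟨$⟩ʳ b))

      letter≡b : letter 1+d<2+k ≡ b
      letter≡b = toℕ-⟨$⟩ʳ-injective p (trans (rank-letter 1+d<2+k) (sym rank-b))

      1+d≢1+k : suc d ≢ suc k
      1+d≢1+k 1+d≡1+k = proj₂ (outside⇒≢ a′≡1+a out)
        (toℕ-⟨$⟩ʳ-injective p (trans rank-b (trans 1+d≡1+k (sym rank-a′))))

      1+d≤k : suc d ≤ k
      1+d≤k = s≤s⁻¹ (≤∧≢⇒< (s≤s⁻¹ 1+d<2+k) 1+d≢1+k)

  open ReplaceAdjacent pos a′≡1+a T T′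

  replaced-order : ∀ b c → rank b < rank c → value (replaced b) < value (replaced c)
  replaced-order b c rb<rc with replaced b | view b | replaced c | view c
  ... | _ | _                 | _ | at-a refl         = contradiction (subst (rank b <_) rank-a rb<rc) n≮0
  ... | _ | at-a′ refl        | _ | _                 =
    contradiction (s≤s⁻¹ (toℕ<n (p ⟨$⟩ʳ c))) (<⇒≱ (subst (_< rank c) rank-a′ rb<rc))
  ... | _ | at-a refl         | _ | at-a′ refl        = <-≤-trans value-T<m m≤value-T′
  ... | _ | at-a refl         | _ | elsewhere out     = <-≤-trans value-T<m (m≤value (proj₁ (outside⇒≢ a′≡1+a out)))
  ... | _ | elsewhere out     | _ | at-a′ refl        = outside-below-T′ out
  ... | _ | elsewhere _       | _ | elsewhere _       = order b c rb<rc

  relocated : Occurrence p (λ x → x ≡ suc (toℕ a)) ∅ π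
  relocated = record
    { pos     = replaced
    ; pos-inc = replaced-increasing pos-inc (subst (_ ≤_) (sym toℕ-T) lo≤point)
                  (subst₂ _<_ (sym toℕ-T) (sym toℕ-T′) ≤-refl) (subst (_≤ _) (sym toℕ-T′) point<hi)
    ; order   = replaced-order
    ; order⁻  = preserves⇒reflects (toℕ-⟨$⟩ʳ-injective p) replaced-order
    ; adjPos  = λ { _ _ refl → replaced-adjacent (trans toℕ-T′ (cong suc (sym toℕ-T))) }
    ; adjVal  = λ _ _ ()
    }

proposition1 : (k : ℕ) → 2 ≤ k → (p : Permutation′ k)
    → (a a′ : Fin k) → toℕ a′ ≡ suc (toℕ a)
    → toℕ (p ⟨$⟩ʳ a) ≡ 0 → toℕ (p ⟨$⟩ʳ a′) ≡ k ∸ 1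
    → (n : ℕ) (π : Permutation′ n)
    → Avoids π p (λ x → x ≡ suc (toℕ a)) ∅
    → Avoids π p ∅ (λ y → (2 ≤ y) × (y ≤ k ∸ 2))
proposition1 (suc (suc k)) (s≤s (s≤s z≤n)) p a a′ a′≡1+a rank-a rank-a′ n π avoids occ =
  avoids (Relocation.relocated k p a′≡1+a rank-a rank-a′ π occ)
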